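{- Let $G$ be a minimal prime graph and $m\ge 0$ an integer. Then $K_{m+1}\boxtimes G$ is a minimal prime graph. Furthermore, $K_{m+1}\boxtimes G$ is isomorphic to the graph obtained from $G$ by duplicating each vertex of $G$ exactly $m$ times.
   Context: All graphs are finite, simple and undirected; $K_r$ is the complete graph on $r$ vertices. The strong product $G\boxtimes H$ has vertex set $V(G)\times V(H)$, and distinct vertices $(u,v),(u',v')$ are adjacent iff ($u=u'$ or $\{u,u'\}\in E(G)$) and ($v=v'$ or $\{v,v'\}\in E(H)$). For a vertex $w$, $N_1[w]$ is its closed neighborhood; vertex duplication of $w$ adds a new vertex $w'$ adjacent exactly to the vertices of $N_1[w]$. "Duplicating each vertex of $G$ exactly $m$ times" means performing, for each original vertex $v$ of $G$, $m$ vertex duplications of $v$ (the resulting graph does not depend on the order). A minimal prime graph is a connected graph $\Gamma$ on two or more vertices such that (1) $\overline{\Gamma}$ is triangle-free, (2) $\overline{\Gamma}$ is 3-colorable, and (3) for every edge $e$ of $\Gamma$, the complement of the graph obtained from $\Gamma$ by deleting $e$ is not both triangle-free and 3-colorable. -}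

module Defs where

open import Data.Nat using (ℕ; zero; suc; _*_; _≤_)
open import Data.Fin using (Fin; zero; suc; inject₁; remQuot; _≟_)
open import Data.Fin.Properties using ()
open import Data.Bool using (Bool; true; false; _∧_; _∨_; not)
open import Data.Maybe using (Maybe; just; nothing)
import Data.Maybe as Maybe
open import Data.List using (List; []; _∷_; map; concatMap; replicate; allFin)
open import Data.Product using (Σ; _×_; _,_; ∃; ∃-syntax)
open import Relation.Binary.PropositionalEquality using (_≡_; _≢_)
open import Relation.Nullary using (¬_)
open import Relation.Nullary.Decidable using (⌊_⌋)
open import Function.Bundles using (_↔_; Inverse)

record Graph : Set where
  constructor graph
  field
    n   : ℕ
    adj : Fin n → Fin n → Bool
open Graph public

IsSimple : Graph → Set
IsSimple G = (∀ u v → adj G u v ≡ adj G v u) × (∀ v → adj G v v ≡ false)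

_==_ : ∀ {k} → Fin k → Fin k → Bool
a == b = ⌊ a ≟ b ⌋

K : ℕ → Graph
K r = graph r (λ i j → not (i == j))

complement : Graph → Graph
complement G = graph (n G) (λ x y → not (x == y) ∧ not (adj G x y))

-- strong product; vertex (u , v) of V(G) × V(H) is encoded as combine u v : Fin (n G * n H)
_⊠_ : Graph → Graph → Graph
G ⊠ H = graph (n G * n H) A
  where
  A : Fin (n G * n H) → Fin (n G * n H) → Bool
  A x y with remQuot (n H) x | remQuot (n H) y
  ... | (u , v) | (u' , v') =
    not ((u == u') ∧ (v == v')) ∧ ((u == u') ∨ adj G u u') ∧ ((v == v') ∨ adj H v v')

data Reachable (G : Graph) : Fin (n G) → Fin (n G) → Set where
  here : ∀ {u} → Reachable G u u
  step : ∀ {u w v} → adj G u w ≡ true → Reachable G w v → Reachable G u v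

Connected : Graph → Set
Connected G = ∀ u v → Reachable G u v

TriangleFree : Graph → Set
TriangleFree G = ∀ a b c → ¬ (adj G a b ≡ true × adj G b c ≡ true × adj G a c ≡ true)

ThreeColorable : Graph → Set
ThreeColorable G =
  Σ (Fin (n G) → Fin 3) λ c → ∀ u v → adj G u v ≡ true → c u ≢ c v

deleteEdge : (G : Graph) → Fin (n G) → Fin (n G) → Graph
deleteEdge G u v =
  graph (n G) (λ x y → adj G x y ∧ not (((x == u) ∧ (y == v)) ∨ ((x == v) ∧ (y == u))))

MinimalPrime : Graph → Set
MinimalPrime G =
  IsSimple G × Connected G × 2 ≤ n G
  × TriangleFree (complement G) × ThreeColorable (complement G)
  × (∀ u v → adj G u v ≡ true →
       ¬ (TriangleFree (complement (deleteEdge G u v))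
          × ThreeColorable (complement (deleteEdge G u v))))

-- Fin (suc k): the last vertex fromℕ k ↦ nothing, inject₁ a ↦ just a
classify : ∀ {k} → Fin (suc k) → Maybe (Fin k)
classify {zero}  zero    = nothing
classify {suc k} zero    = just zero
classify {suc k} (suc i) = Maybe.map suc (classify i)

-- vertex duplication of w: the new vertex (the last one, fromℕ k) is adjacent
-- exactly to the vertices of N_1[w]; old vertices are embedded via inject₁
duplicate : (G : Graph) → Fin (n G) → Graph
duplicate G w = graph (suc (n G)) A
  where
  A : Fin (suc (n G)) → Fin (suc (n G)) → Bool
  A x y with classify x | classify y
  ... | just a  | just b  = adj G a b
  ... | just a  | nothing = (a == w) ∨ adj G w a
  ... | nothing | just b  = (b == w) ∨ adj G w b
  ... | nothing | nothing = false

-- perform a sequence of vertex duplications of vertices of an original vertex set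
-- Fin k, embedded into the current graph by e (re-embedded via inject₁ after each step)
duplicateList : ∀ {k} (G : Graph) → (Fin k → Fin (n G)) → List (Fin k) → Graph
duplicateList G e []       = G
duplicateList G e (v ∷ vs) = duplicateList (duplicate G (e v)) (λ x → inject₁ (e x)) vs

duplicateEach : ℕ → Graph → Graph
duplicateEach m G = duplicateList G (λ x → x) (concatMap (replicate m) (allFin (n G)))

_≅_ : Graph → Graph → Set
G ≅ H = Σ (Fin (n G) ↔ Fin (n H)) λ f →
  ∀ x y → adj G x y ≡ adj H (Inverse.to f x) (Inverse.to f y)

{-# OPTIONS --safe #-}
-- K (suc m) ⊠ G and the graph obtained by duplicating every vertex of G m times are both
-- blow-ups of G: every vertex v becomes a clique of m + 1 vertices, and two such cliques are
-- completely joined exactly when their origins are adjacent in G.  A bijection between two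
-- blow-ups of G that respects the origin maps is an isomorphism, which gives the second claim.
--
-- The complement of a blow-up H of G is the pullback of the complement of G along the origin
-- map, so it inherits triangle-freeness and 3-colourability.  For minimality, deleting an edge
-- xy of H whose ends lie over distinct vertices a, b of G pulls back (along a section of the
-- origin map through x and y) to deleting the edge ab of G.  Deleting an edge xy inside a fibre
-- creates the complement triangle x, y, z for any z over a non-neighbour of the common origin;
-- such a non-neighbour exists because a minimal prime graph has no universal vertex a, for
-- deleting an edge aw would only add the pendant edge aw to the complement.
module Submission where

open import Defs
open import Data.Bool using (Bool; true; false; _∧_; _∨_; not)
import Data.Bool as Bool
open import Data.Bool.Properties using (not-¬; ¬-not; not-injective; ∨-zeroʳ)
open import Data.Empty using (⊥; ⊥-elim)
open import Data.Fin using (Fin; zero; suc; _≟_; punchIn; combine; remQuot; quotRem; inject₁; fromℕ)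
open import Data.Fin.Properties
  using (any?; punchInᵢ≢i; injective⇒≤; remQuot-combine; combine-remQuot; combine-injective;
         inject₁-injective; fromℕ≢inject₁; *↔×)
open import Data.List using (List; []; _∷_; _++_; lookup; replicate; tabulate; concatMap; allFin)
open import Data.Maybe using (just; nothing; maybe)
open import Data.Nat using (ℕ; zero; suc; _≤_; s≤s)
open import Data.Nat.Properties using (≤-trans)
open import Data.Product using (Σ; ∃; _×_; _,_; proj₁; proj₂; swap)
import Data.Product as Product
open import Data.Product.Algebra using (×-comm)
open import Data.Sum using (_⊎_; inj₁; inj₂; [_,_]; [_,_]′)
open import Data.Sum.Algebra using (⊎-assoc)
open import Data.Sum.Function.Propositional using (_⊎-↔_)
open import Data.Unit using (⊤; tt)
open import Function using (_∘_; const; id)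
open import Function.Bundles using (_↔_; Inverse; Injection; mk↔ₛ′)
open import Function.Definitions using (Injective)
open import Function.Properties.Inverse using (↔-refl; ↔-trans; ↔-sym; ↔⇒↣)
open import Level using (0ℓ)
open import Relation.Binary.PropositionalEquality using (_≡_; _≢_; refl; sym; trans; cong; cong₂; subst; subst₂)
open import Relation.Nullary using (¬_; Dec; yes; no)

==-refl : ∀ {k} (a : Fin k) → (a == a) ≡ true
==-refl a with a ≟ a
... | yes _ = refl
... | no a≢a = ⊥-elim (a≢a refl)

≢⇒==-false : ∀ {k} {a b : Fin k} → a ≢ b → (a == b) ≡ false
≢⇒==-false {a = a} {b} a≢b with a ≟ b
... | yes a≡b = ⊥-elim (a≢b a≡b)
... | no _ = refl

==⇒≡ : ∀ {k} {a b : Fin k} → (a == b) ≡ true → a ≡ b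
==⇒≡ {a = a} {b} with a ≟ b
... | yes a≡b = λ _ → a≡b
... | no _ = λ ()

==-sym : ∀ {k} (a b : Fin k) → (a == b) ≡ (b == a)
==-sym a b with a ≟ b | b ≟ a
... | yes _ | yes _ = refl
... | no _ | no _ = refl
... | yes a≡b | no b≢a = ⊥-elim (b≢a (sym a≡b))
... | no a≢b | yes b≡a = ⊥-elim (a≢b (sym b≡a))

==-injective : ∀ {k l} {f : Fin k → Fin l} → Injective _≡_ _≡_ f →
               ∀ a b → (f a == f b) ≡ (a == b)
==-injective {f = f} f-inj a b with a ≟ b | f a ≟ f b
... | yes _ | yes _ = refl
... | no _ | no _ = refl
... | yes a≡b | no fa≢fb = ⊥-elim (fa≢fb (cong f a≡b))
... | no a≢b | yes fa≡fb = ⊥-elim (a≢b (f-inj fa≡fb))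

==-combine : ∀ {M N} (i j : Fin M) (u v : Fin N) → (combine i u == combine j v) ≡ (i == j) ∧ (u == v)
==-combine i j u v with i ≟ j | u ≟ v | combine i u ≟ combine j v
... | yes refl | yes refl | yes _ = refl
... | yes refl | yes refl | no c≢c = ⊥-elim (c≢c refl)
... | no i≢j | _ | yes c≡c = ⊥-elim (i≢j (proj₁ (combine-injective i u j v c≡c)))
... | yes _ | no u≢v | yes c≡c = ⊥-elim (u≢v (proj₂ (combine-injective i u j v c≡c)))
... | no _ | _ | no _ = refl
... | yes _ | no _ | no _ = refl

-- remQuot unfolds to swap ∘ quotRem, so adjacency in _⊠_ computes on quotRem.
quotRem-combine : ∀ {M N} (i : Fin M) (u : Fin N) → quotRem N (combine i u) ≡ (u , i)
quotRem-combine i u = cong swap (remQuot-combine i u)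

Symmetric : Graph → Set
Symmetric G = ∀ u v → adj G u v ≡ adj G v u

loopless-adj⇒≢ : ∀ {G u v} → (∀ w → adj G w w ≡ false) → adj G u v ≡ true → u ≢ v
loopless-adj⇒≢ G-loopless uv refl = not-¬ uv (G-loopless _)

Homomorphism : (G H : Graph) → (Fin (n G) → Fin (n H)) → Set
Homomorphism G H f = ∀ x y → adj G x y ≡ true → adj H (f x) (f y) ≡ true

triangleFree-reflect : ∀ {G H f} → Homomorphism G H f → TriangleFree H → TriangleFree G
triangleFree-reflect {f = f} hom tf a b c (ab , bc , ac) =
  tf (f a) (f b) (f c) (hom a b ab , hom b c bc , hom a c ac)

threeColorable-reflect : ∀ {G H f} → Homomorphism G H f → ThreeColorable H → ThreeColorable G
threeColorable-reflect {f = f} hom (colour , proper) =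
  colour ∘ f , λ u v uv → proper (f u) (f v) (hom u v uv)

reachable-trans : ∀ {G a b c} → Reachable G a b → Reachable G b c → Reachable G a c
reachable-trans here        r′ = r′
reachable-trans (step e r) r′ = step e (reachable-trans r r′)

reachable-map : ∀ {G H f} → Homomorphism G H f → ∀ {a b} → Reachable G a b → Reachable H (f a) (f b)
reachable-map hom here                   = here
reachable-map hom (step {u} {w} uw r) = step (hom u w uw) (reachable-map hom r)

cadj : (G : Graph) → Fin (n G) → Fin (n G) → Bool
cadj G = adj (complement G)

complement-sym : ∀ {G} → Symmetric G → ∀ p q → cadj G p q ≡ cadj G q p
complement-sym {G} G-sym p q rewrite ==-sym p q | G-sym p q = refl

complement-irreflexive : ∀ G {p q} → cadj G p q ≡ true → p ≢ q
complement-irreflexive G {p} {q} with p ≟ q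
... | yes _ = λ ()
... | no p≢q = λ _ → p≢q

complement-⊆-deleteEdge : ∀ G u v p q → cadj G p q ≡ true → cadj (deleteEdge G u v) p q ≡ true
complement-⊆-deleteEdge G u v p q with p == q | adj G p q
... | false | false = λ _ → refl
... | false | true = λ ()
... | true  | _ = λ ()

deleteEdge-complement-edge : ∀ G {u v} → u ≢ v → cadj (deleteEdge G u v) u v ≡ true
deleteEdge-complement-edge G {u} {v} u≢v
  rewrite ==-refl u | ==-refl v | ≢⇒==-false u≢v with adj G u v
... | true = refl
... | false = refl

deleteEdge-complement-edge′ : ∀ G {u v} → u ≢ v → cadj (deleteEdge G u v) v u ≡ true
deleteEdge-complement-edge′ G {u} {v} u≢v
  rewrite ==-refl u | ==-refl v | ≢⇒==-false (u≢v ∘ sym) with adj G v u | v == u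
... | true  | _ = refl
... | false | _ = refl

deleted-ends : ∀ {k} (p q u v : Fin k) → ((p == u ∧ q == v) ∨ (p == v ∧ q == u)) ≡ true →
  (p ≡ u × q ≡ v) ⊎ (p ≡ v × q ≡ u)
deleted-ends p q u v with p == u in pu | q == v in qv | p == v in pv | q == u in qu
... | true  | true  | _     | _     = λ _ → inj₁ (==⇒≡ pu , ==⇒≡ qv)
... | _     | _     | true  | true  = λ _ → inj₂ (==⇒≡ pv , ==⇒≡ qu)
... | false | _     | false | _     = λ ()
... | false | _     | true  | false = λ ()
... | true  | false | false | _     = λ ()
... | true  | false | true  | false = λ ()

complement-deleteEdge-cases : ∀ G u v p q → cadj (deleteEdge G u v) p q ≡ true →
  ((p ≡ u × q ≡ v) ⊎ (p ≡ v × q ≡ u)) ⊎ cadj G p q ≡ true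
complement-deleteEdge-cases G u v p q with (p == u ∧ q == v) ∨ (p == v ∧ q == u) in deleted
... | true = λ _ → inj₁ (deleted-ends p q u v deleted)
... | false with p == q | adj G p q
...   | false | false = λ _ → inj₂ refl
...   | false | true  = λ ()
...   | true  | _     = λ ()

Universal : (G : Graph) → Fin (n G) → Set
Universal G a = ∀ q → cadj G a q ≡ false

nextColour : Fin 3 → Fin 3
nextColour zero = suc zero
nextColour (suc zero) = suc (suc zero)
nextColour (suc (suc zero)) = zero

nextColour-≢ : ∀ c → nextColour c ≢ c
nextColour-≢ zero ()
nextColour-≢ (suc zero) ()
nextColour-≢ (suc (suc zero)) ()

module _ {G : Graph} (G-sym : Symmetric G) {a w : Fin (n G)}
         (a-universal : Universal G a) (w≢a : w ≢ a) where

  private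
    D : Graph
    D = deleteEdge G a w

    from-a : ∀ {p q} → p ≡ a → cadj D p q ≡ true → q ≡ w
    from-a {q = q} refl e with complement-deleteEdge-cases G a w a q e
    ... | inj₁ (inj₁ (_ , q≡w)) = q≡w
    ... | inj₁ (inj₂ (a≡w , _)) = ⊥-elim (w≢a (sym a≡w))
    ... | inj₂ aq = ⊥-elim (not-¬ aq (a-universal q))

    to-a : ∀ {p q} → q ≡ a → cadj D p q ≡ true → p ≡ w
    to-a {p} refl e with complement-deleteEdge-cases G a w p a e
    ... | inj₁ (inj₁ (_ , a≡w)) = ⊥-elim (w≢a (sym a≡w))
    ... | inj₁ (inj₂ (p≡w , _)) = p≡w
    ... | inj₂ pa = ⊥-elim (not-¬ (trans (complement-sym G-sym a p) pa) (a-universal p))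

    away-from-a : ∀ {p q} → p ≢ a → q ≢ a → cadj D p q ≡ true → cadj G p q ≡ true
    away-from-a {p} {q} p≢a q≢a e with complement-deleteEdge-cases G a w p q e
    ... | inj₁ (inj₁ (p≡a , _)) = ⊥-elim (p≢a p≡a)
    ... | inj₁ (inj₂ (_ , q≡a)) = ⊥-elim (q≢a q≡a)
    ... | inj₂ pq = pq

  universal-deleteEdge-triangleFree : TriangleFree (complement G) → TriangleFree (complement D)
  universal-deleteEdge-triangleFree tf p q r (pq , qr , pr) = through-a? (p ≟ a) (q ≟ a) (r ≟ a)
    where
    through-a? : Dec (p ≡ a) → Dec (q ≡ a) → Dec (r ≡ a) → ⊥
    through-a? (yes p≡a) _ _ = complement-irreflexive D qr (trans (from-a p≡a pq) (sym (from-a p≡a pr)))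
    through-a? _ (yes q≡a) _ = complement-irreflexive D pr (trans (to-a q≡a pq) (sym (from-a q≡a qr)))
    through-a? _ _ (yes r≡a) = complement-irreflexive D pq (trans (to-a r≡a pr) (sym (to-a r≡a qr)))
    through-a? (no p≢a) (no q≢a) (no r≢a) =
      tf p q r (away-from-a p≢a q≢a pq , away-from-a q≢a r≢a qr , away-from-a p≢a r≢a pr)

  universal-deleteEdge-threeColorable : ThreeColorable (complement G) → ThreeColorable (complement D)
  universal-deleteEdge-threeColorable (colour , proper) = recolour , recolour-proper
    where
    recolour : Fin (n G) → Fin 3
    recolour v with v ≟ a
    ... | yes _ = nextColour (colour w)
    ... | no _ = colour v

    recolour-a : recolour a ≡ nextColour (colour w)
    recolour-a with a ≟ a
    ... | yes _ = refl
    ... | no a≢a = ⊥-elim (a≢a refl)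

    recolour-≢a : ∀ {v} → v ≢ a → recolour v ≡ colour v
    recolour-≢a {v} v≢a with v ≟ a
    ... | yes v≡a = ⊥-elim (v≢a v≡a)
    ... | no _ = refl

    recolour-proper : ∀ u v → cadj D u v ≡ true → recolour u ≢ recolour v
    recolour-proper u v e with complement-deleteEdge-cases G a w u v e
    ... | inj₁ (inj₁ (refl , refl)) = λ eq →
      nextColour-≢ (colour w) (trans (sym recolour-a) (trans eq (recolour-≢a w≢a)))
    ... | inj₁ (inj₂ (refl , refl)) = λ eq →
      nextColour-≢ (colour w) (trans (sym recolour-a) (trans (sym eq) (recolour-≢a w≢a)))
    ... | inj₂ uv = λ eq → proper u v uv (trans (sym (recolour-≢a u≢a)) (trans eq (recolour-≢a v≢a)))
      where
      u≢a : u ≢ a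
      u≢a refl = not-¬ uv (a-universal v)
      v≢a : v ≢ a
      v≢a refl = not-¬ (trans (complement-sym G-sym a u) uv) (a-universal u)

another-vertex : ∀ {k} → 2 ≤ k → (a : Fin k) → ∃ λ w → w ≢ a
another-vertex (s≤s (s≤s _)) a = punchIn a zero , punchInᵢ≢i a zero

universal-adj : ∀ {G a w} → Universal G a → w ≢ a → adj G a w ≡ true
universal-adj {G} {a} {w} a-universal w≢a =
  not-injective (subst (λ b → not b ∧ not (adj G a w) ≡ false) (≢⇒==-false (w≢a ∘ sym)) (a-universal w))

minimalPrime⇒¬universal : ∀ {G} → MinimalPrime G → ∀ a → ¬ Universal G a
minimalPrime⇒¬universal {G} ((G-sym , _) , _ , 2≤n , tf , col , minimal) a a-universal
  with another-vertex 2≤n a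
... | w , w≢a = minimal a w (universal-adj {G} a-universal w≢a)
  ( universal-deleteEdge-triangleFree G-sym a-universal w≢a tf
  , universal-deleteEdge-threeColorable G-sym a-universal w≢a col )

minimalPrime-complement-neighbour : ∀ {G} → MinimalPrime G → ∀ a → ∃ λ w → cadj G a w ≡ true
minimalPrime-complement-neighbour {G} mp a with any? (λ w → cadj G a w Bool.≟ true)
... | yes neighbour = neighbour
... | no no-neighbour = ⊥-elim (minimalPrime⇒¬universal mp a (λ w → ¬-not (no-neighbour ∘ (w ,_))))

blowupAdj : (G : Graph) {N : ℕ} → (Fin N → Fin (n G)) → Fin N → Fin N → Bool
blowupAdj G origin x y = not (x == y) ∧ ((origin x == origin y) ∨ adj G (origin x) (origin y))

record Blowup (G H : Graph) : Set where
  field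
    origin      : Fin (n H) → Fin (n G)
    lift        : Fin (n G) → Fin (n H)
    origin-lift : ∀ v → origin (lift v) ≡ v
    adj-blowup  : ∀ x y → adj H x y ≡ blowupAdj G origin x y

module BlowupProperties {G H : Graph} (B : Blowup G H) where
  open Blowup B

  lift-injective : Injective _≡_ _≡_ lift
  lift-injective {u} {v} e = trans (sym (origin-lift u)) (trans (cong origin e) (origin-lift v))

  complement-blowup : ∀ x y → cadj H x y ≡ cadj G (origin x) (origin y)
  complement-blowup x y rewrite adj-blowup x y with x ≟ y
  ... | yes refl rewrite ==-refl (origin x) = refl
  ... | no _ with origin x == origin y | adj G (origin x) (origin y)
  ...   | true  | _     = refl
  ...   | false | true  = refl
  ...   | false | false = refl

  complement-section : ∀ {f : Fin (n G) → Fin (n H)} → (∀ v → origin (f v) ≡ v) →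
                       ∀ p q → cadj H (f p) (f q) ≡ cadj G p q
  complement-section {f} section p q =
    trans (complement-blowup (f p) (f q)) (cong₂ (cadj G) (section p) (section q))

  origin-homomorphism : Homomorphism (complement H) (complement G) origin
  origin-homomorphism x y xy = trans (sym (complement-blowup x y)) xy

  blowup-symmetric : Symmetric G → Symmetric H
  blowup-symmetric G-sym x y rewrite adj-blowup x y | adj-blowup y x
    | ==-sym x y | ==-sym (origin x) (origin y) | G-sym (origin x) (origin y) = refl

  blowup-loopless : ∀ x → adj H x x ≡ false
  blowup-loopless x rewrite adj-blowup x x | ==-refl x = refl

  blowup-isSimple : IsSimple G → IsSimple H
  blowup-isSimple (G-sym , _) = blowup-symmetric G-sym , blowup-loopless

  lift-homomorphism : (∀ v → adj G v v ≡ false) → Homomorphism G H lift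
  lift-homomorphism G-loopless u v uv
    rewrite adj-blowup (lift u) (lift v)
    | ≢⇒==-false {a = lift u} {lift v} (loopless-adj⇒≢ G-loopless uv ∘ lift-injective)
    | origin-lift u | origin-lift v | uv = ∨-zeroʳ (u == v)

  fibre-reachable : ∀ {x y} → origin x ≡ origin y → Reachable H x y
  fibre-reachable {x} {y} ox≡oy with x ≟ y
  ... | yes refl = here
  ... | no x≢y = step x~y here
    where
    x~y : adj H x y ≡ true
    x~y rewrite adj-blowup x y | ≢⇒==-false x≢y | ox≡oy | ==-refl (origin y) = refl

  blowup-connected : (∀ v → adj G v v ≡ false) → Connected G → Connected H
  blowup-connected G-loopless G-connected x y =
    reachable-trans (fibre-reachable (sym (origin-lift (origin x))))
      (reachable-trans (reachable-map (lift-homomorphism G-loopless) (G-connected (origin x) (origin y)))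
        (fibre-reachable (origin-lift (origin y))))

  blowup-size : 2 ≤ n G → 2 ≤ n H
  blowup-size 2≤n = ≤-trans 2≤n (injective⇒≤ lift-injective)

  adj-distinct-origins : ∀ {x y} → origin x ≢ origin y → adj H x y ≡ adj G (origin x) (origin y)
  adj-distinct-origins {x} {y} ox≢oy
    rewrite adj-blowup x y | ≢⇒==-false (ox≢oy ∘ cong origin) | ≢⇒==-false ox≢oy = refl

  module SectionThrough {x y : Fin (n H)} (ox≢oy : origin x ≢ origin y) where

    lift₂ : Fin (n G) → Fin (n H)
    lift₂ v with v ≟ origin x | v ≟ origin y
    ... | yes _ | _     = x
    ... | no _  | yes _ = y
    ... | no _  | no _  = lift v

    origin-lift₂ : ∀ v → origin (lift₂ v) ≡ v
    origin-lift₂ v with v ≟ origin x | v ≟ origin y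
    ... | yes v≡ox | _        = sym v≡ox
    ... | no _     | yes v≡oy = sym v≡oy
    ... | no _     | no _     = origin-lift v

    lift₂-x : lift₂ (origin x) ≡ x
    lift₂-x with origin x ≟ origin x
    ... | yes _ = refl
    ... | no ox≢ox = ⊥-elim (ox≢ox refl)

    lift₂-y : lift₂ (origin y) ≡ y
    lift₂-y with origin y ≟ origin x | origin y ≟ origin y
    ... | yes oy≡ox | _ = ⊥-elim (ox≢oy (sym oy≡ox))
    ... | no _ | yes _ = refl
    ... | no _ | no oy≢oy = ⊥-elim (oy≢oy refl)

    lift₂-homomorphism : Homomorphism (complement (deleteEdge G (origin x) (origin y)))
                                      (complement (deleteEdge H x y)) lift₂
    lift₂-homomorphism p q pq with complement-deleteEdge-cases G (origin x) (origin y) p q pq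
    ... | inj₁ (inj₁ (refl , refl)) rewrite lift₂-x | lift₂-y =
      deleteEdge-complement-edge H (ox≢oy ∘ cong origin)
    ... | inj₁ (inj₂ (refl , refl)) rewrite lift₂-x | lift₂-y =
      deleteEdge-complement-edge′ H (ox≢oy ∘ cong origin)
    ... | inj₂ pq-in-G = complement-⊆-deleteEdge H x y (lift₂ p) (lift₂ q)
      (trans (complement-section origin-lift₂ p q) pq-in-G)

  blowup-minimal : MinimalPrime G → ∀ x y → adj H x y ≡ true →
    ¬ (TriangleFree (complement (deleteEdge H x y)) × ThreeColorable (complement (deleteEdge H x y)))
  blowup-minimal mp@(_ , _ , _ , _ , _ , minimal) x y xy (tf , col) with origin x ≟ origin y
  ... | no ox≢oy = minimal (origin x) (origin y) (trans (sym (adj-distinct-origins ox≢oy)) xy)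
        (triangleFree-reflect lift₂-homomorphism tf , threeColorable-reflect lift₂-homomorphism col)
    where open SectionThrough ox≢oy
  ... | yes ox≡oy with minimalPrime-complement-neighbour mp (origin x)
  ...   | w , ox≁w = tf x y (lift w)
          ( deleteEdge-complement-edge H (loopless-adj⇒≢ blowup-loopless xy)
          , complement-⊆-deleteEdge H x y y (lift w) (lifted-neighbour (sym ox≡oy))
          , complement-⊆-deleteEdge H x y x (lift w) (lifted-neighbour refl) )
    where
    lifted-neighbour : ∀ {z} → origin z ≡ origin x → cadj H z (lift w) ≡ true
    lifted-neighbour {z} oz≡ox =
      trans (complement-blowup z (lift w)) (trans (cong₂ (cadj G) oz≡ox (origin-lift w)) ox≁w)

  blowup-minimalPrime : MinimalPrime G → MinimalPrime H
  blowup-minimalPrime mp@((G-sym , G-loopless) , G-connected , 2≤n , tf , col , _) =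
    blowup-isSimple (G-sym , G-loopless) , blowup-connected G-loopless G-connected , blowup-size 2≤n
    , triangleFree-reflect origin-homomorphism tf , threeColorable-reflect origin-homomorphism col
    , blowup-minimal mp

identity-blowup : ∀ G → IsSimple G → Blowup G G
identity-blowup G (_ , G-loopless) = record
  { origin = λ x → x ; lift = λ x → x ; origin-lift = λ _ → refl ; adj-blowup = adj-self }
  where
  adj-self : ∀ x y → adj G x y ≡ blowupAdj G (λ x → x) x y
  adj-self x y with x ≟ y
  ... | yes refl = G-loopless x
  ... | no _ = refl

strongProduct-adj-combine : ∀ M G (i j : Fin M) (u v : Fin (n G)) →
  adj (K M ⊠ G) (combine i u) (combine j v)
    ≡ blowupAdj G (proj₂ ∘ remQuot {M} (n G)) (combine i u) (combine j v)
strongProduct-adj-combine M G i j u v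
  rewrite quotRem-combine i u | quotRem-combine j v | ==-combine i j u v with i == j
... | true = refl
... | false = refl

strongProduct-adj : ∀ M G x y → adj (K M ⊠ G) x y ≡ blowupAdj G (proj₂ ∘ remQuot {M} (n G)) x y
strongProduct-adj M G x y =
  subst₂ (λ x′ y′ → adj (K M ⊠ G) x′ y′ ≡ blowupAdj G (proj₂ ∘ remQuot {M} (n G)) x′ y′)
    (combine-remQuot {M} (n G) x) (combine-remQuot {M} (n G) y)
    (strongProduct-adj-combine M G _ _ _ _)

strongProduct-blowup : ∀ m G → Blowup G (K (suc m) ⊠ G)
strongProduct-blowup m G = record
  { origin      = λ x → proj₂ (remQuot {suc m} (n G) x)
  ; lift        = combine {suc m} zero
  ; origin-lift = cong proj₂ ∘ remQuot-combine {suc m} zero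
  ; adj-blowup  = strongProduct-adj (suc m) G
  }

classify-inject₁ : ∀ {k} (a : Fin k) → classify (inject₁ a) ≡ just a
classify-inject₁ {suc k} zero = refl
classify-inject₁ {suc k} (suc a) rewrite classify-inject₁ a = refl

classify-fromℕ : ∀ k → classify (fromℕ k) ≡ nothing
classify-fromℕ zero = refl
classify-fromℕ (suc k) rewrite classify-fromℕ k = refl

classify≡just⇒inject₁ : ∀ {k} {x : Fin (suc k)} {a} → classify x ≡ just a → x ≡ inject₁ a
classify≡just⇒inject₁ {zero} {zero} ()
classify≡just⇒inject₁ {suc k} {zero} refl = refl
classify≡just⇒inject₁ {suc k} {suc x} e with classify x in ex
classify≡just⇒inject₁ {suc k} {suc x} refl | just b = cong suc (classify≡just⇒inject₁ ex)

classify≡nothing⇒fromℕ : ∀ {k} {x : Fin (suc k)} → classify x ≡ nothing → x ≡ fromℕ k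
classify≡nothing⇒fromℕ {zero} {zero} refl = refl
classify≡nothing⇒fromℕ {suc k} {zero} ()
classify≡nothing⇒fromℕ {suc k} {suc x} e with classify x in ex
classify≡nothing⇒fromℕ {suc k} {suc x} refl | nothing = cong suc (classify≡nothing⇒fromℕ ex)

module _ {G H : Graph} (G-sym : Symmetric G) (B : Blowup G H) where
  open Blowup B

  closedNeighbourhood-blowup : ∀ a w →
    ((a == w) ∨ adj H w a) ≡ ((origin a == origin w) ∨ adj G (origin a) (origin w))
  closedNeighbourhood-blowup a w with a ≟ w
  ... | yes refl rewrite ==-refl (origin a) = refl
  ... | no a≢w rewrite adj-blowup w a | ≢⇒==-false (a≢w ∘ sym)
        | ==-sym (origin w) (origin a) | G-sym (origin w) (origin a) = refl

  duplicate-blowup : (w : Fin (n H)) → Blowup G (duplicate H w)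
  duplicate-blowup w = record
    { origin      = origin′
    ; lift        = inject₁ ∘ lift
    ; origin-lift = λ v →
        trans (cong (maybe origin (origin w)) (classify-inject₁ (lift v))) (origin-lift v)
    ; adj-blowup  = adj-duplicate
    }
    where
    origin′ : Fin (suc (n H)) → Fin (n G)
    origin′ = maybe origin (origin w) ∘ classify

    adj-duplicate : ∀ x y → adj (duplicate H w) x y ≡ blowupAdj G origin′ x y
    adj-duplicate x y with classify x in ex | classify y in ey
    ... | just a | just b
      with refl ← classify≡just⇒inject₁ ex | refl ← classify≡just⇒inject₁ ey
      rewrite ==-injective inject₁-injective a b = adj-blowup a b
    ... | just a | nothing
      with refl ← classify≡just⇒inject₁ ex | refl ← classify≡nothing⇒fromℕ ey
      rewrite ≢⇒==-false (fromℕ≢inject₁ {i = a} ∘ sym) = closedNeighbourhood-blowup a w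
    ... | nothing | just b
      with refl ← classify≡nothing⇒fromℕ ex | refl ← classify≡just⇒inject₁ ey
      rewrite ≢⇒==-false (fromℕ≢inject₁ {i = b})
      | ==-sym (origin w) (origin b) | G-sym (origin w) (origin b) = closedNeighbourhood-blowup b w
    ... | nothing | nothing
      with refl ← classify≡nothing⇒fromℕ ex | refl ← classify≡nothing⇒fromℕ ey
      rewrite ==-refl x = refl

record FibreIso {X A B : Set} (oA : A → X) (oB : B → X) : Set where
  constructor mkFibreIso
  field
    iso  : A ↔ B
    over : ∀ a → oB (Inverse.to iso a) ≡ oA a

module _ {X : Set} where

  fibreIso-refl : ∀ {A} {o : A → X} → FibreIso o o
  fibreIso-refl = mkFibreIso ↔-refl λ _ → refl

  fibreIso-trans : ∀ {A B C} {oA : A → X} {oB : B → X} {oC : C → X} →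
                   FibreIso oA oB → FibreIso oB oC → FibreIso oA oC
  fibreIso-trans (mkFibreIso f f-over) (mkFibreIso g g-over) =
    mkFibreIso (↔-trans f g) λ a → trans (g-over _) (f-over a)

  fibreIso-sym : ∀ {A B} {oA : A → X} {oB : B → X} → FibreIso oA oB → FibreIso oB oA
  fibreIso-sym {oB = oB} (mkFibreIso f f-over) =
    mkFibreIso (↔-sym f) λ b →
      trans (sym (f-over (Inverse.from f b))) (cong oB (Inverse.strictlyInverseˡ f b))

  fibreIso-⊎ : ∀ {A B C D} {oA : A → X} {oB : B → X} {oC : C → X} {oD : D → X} →
               FibreIso oA oC → FibreIso oB oD → FibreIso [ oA , oB ]′ [ oC , oD ]′
  fibreIso-⊎ (mkFibreIso f f-over) (mkFibreIso g g-over) = mkFibreIso (f ⊎-↔ g) [ f-over , g-over ]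

  fibreIso-assoc : ∀ {A B C} (oA : A → X) (oB : B → X) (oC : C → X) →
                   FibreIso [ [ oA , oB ]′ , oC ]′ [ oA , [ oB , oC ]′ ]′
  fibreIso-assoc {A} {B} {C} _ _ _ =
    mkFibreIso (⊎-assoc 0ℓ A B C) [ [ (λ _ → refl) , (λ _ → refl) ] , (λ _ → refl) ]

  fibreIso-swap : ∀ {A B} (o : A × B → X) → FibreIso o (o ∘ swap)
  fibreIso-swap {A} {B} _ = mkFibreIso (×-comm A B) λ _ → refl

  fibreIso-Fin-suc : ∀ {k} (o : Fin (suc k) → X) → FibreIso o [ const (o zero) , o ∘ suc ]′
  fibreIso-Fin-suc {k} o = mkFibreIso (mk↔ₛ′ split unsplit split∘unsplit unsplit∘split) over
    where
    split : Fin (suc k) → ⊤ ⊎ Fin k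
    split zero    = inj₁ tt
    split (suc i) = inj₂ i
    unsplit : ⊤ ⊎ Fin k → Fin (suc k)
    unsplit = [ const zero , suc ]
    split∘unsplit : ∀ z → split (unsplit z) ≡ z
    split∘unsplit (inj₁ tt) = refl
    split∘unsplit (inj₂ i)  = refl
    unsplit∘split : ∀ i → unsplit (split i) ≡ i
    unsplit∘split zero    = refl
    unsplit∘split (suc i) = refl
    over : ∀ i → [ const (o zero) , o ∘ suc ]′ (split i) ≡ o i
    over zero    = refl
    over (suc i) = refl

  fibreIso-Fin-suc× : ∀ {k A} (o : Fin (suc k) × A → X) →
                      FibreIso o [ (λ a → o (zero , a)) , o ∘ Product.map₁ suc ]′
  fibreIso-Fin-suc× {k} {A} o = mkFibreIso (mk↔ₛ′ split unsplit split∘unsplit unsplit∘split) over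
    where
    split : Fin (suc k) × A → A ⊎ (Fin k × A)
    split (zero  , a) = inj₁ a
    split (suc i , a) = inj₂ (i , a)
    unsplit : A ⊎ (Fin k × A) → Fin (suc k) × A
    unsplit = [ (zero ,_) , Product.map₁ suc ]
    split∘unsplit : ∀ z → split (unsplit z) ≡ z
    split∘unsplit (inj₁ a) = refl
    split∘unsplit (inj₂ p) = refl
    unsplit∘split : ∀ p → unsplit (split p) ≡ p
    unsplit∘split (zero  , a) = refl
    unsplit∘split (suc i , a) = refl
    over : ∀ p → [ (λ a → o (zero , a)) , o ∘ Product.map₁ suc ]′ (split p) ≡ o p
    over (zero  , a) = refl
    over (suc i , a) = refl

  fibreIso-Fin0ˡ : ∀ {A} (o₀ : Fin 0 → X) (o : A → X) → FibreIso [ o₀ , o ]′ o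
  fibreIso-Fin0ˡ _ _ =
    mkFibreIso (mk↔ₛ′ [ (λ ()) , id ] inj₂ (λ _ → refl) [ (λ ()) , (λ _ → refl) ]) [ (λ ()) , (λ _ → refl) ]

  fibreIso-Fin0ʳ : ∀ {A} (o : A → X) (o₀ : Fin 0 → X) → FibreIso [ o , o₀ ]′ o
  fibreIso-Fin0ʳ _ _ =
    mkFibreIso (mk↔ₛ′ [ id , (λ ()) ] inj₁ (λ _ → refl) [ (λ _ → refl) , (λ ()) ]) [ (λ _ → refl) , (λ ()) ]

  fibreIso-Fin0× : ∀ {A} (o : Fin 0 × A → X) (o₀ : Fin 0 → X) → FibreIso o o₀
  fibreIso-Fin0× _ _ = mkFibreIso (mk↔ₛ′ (λ ()) (λ ()) (λ ()) (λ ())) λ ()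

  infixr 2 _↔⟨_⟩_
  infix  3 _∎

  _↔⟨_⟩_ : ∀ {A B C} (oA : A → X) {oB : B → X} {oC : C → X} →
           FibreIso oA oB → FibreIso oB oC → FibreIso oA oC
  _ ↔⟨ f ⟩ g = fibreIso-trans f g

  _∎ : ∀ {A} (o : A → X) → FibreIso o o
  _ ∎ = fibreIso-refl

  fibreIso-replicate : ∀ m (a : X) → FibreIso {A = Fin m} (const a) (lookup (replicate m a))
  fibreIso-replicate zero    a = mkFibreIso ↔-refl λ ()
  fibreIso-replicate (suc m) a =
    const a                                  ↔⟨ fibreIso-Fin-suc (const a) ⟩
    [ const a , const a ]′                   ↔⟨ fibreIso-⊎ fibreIso-refl (fibreIso-replicate m a) ⟩
    [ const a , lookup (replicate m a) ]′    ↔⟨ fibreIso-sym (fibreIso-Fin-suc (lookup (replicate (suc m) a))) ⟩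
    lookup (replicate (suc m) a)             ∎

  fibreIso-++ : ∀ (ys zs : List X) → FibreIso [ lookup ys , lookup zs ]′ (lookup (ys ++ zs))
  fibreIso-++ []       zs = fibreIso-Fin0ˡ (lookup []) (lookup zs)
  fibreIso-++ (y ∷ ys) zs =
    [ lookup (y ∷ ys) , lookup zs ]′            ↔⟨ fibreIso-⊎ (fibreIso-Fin-suc (lookup (y ∷ ys))) fibreIso-refl ⟩
    [ [ const y , lookup ys ]′ , lookup zs ]′   ↔⟨ fibreIso-assoc (const y) (lookup ys) (lookup zs) ⟩
    [ const y , [ lookup ys , lookup zs ]′ ]′   ↔⟨ fibreIso-⊎ fibreIso-refl (fibreIso-++ ys zs) ⟩
    [ const y , lookup (ys ++ zs) ]′            ↔⟨ fibreIso-sym (fibreIso-Fin-suc (lookup (y ∷ ys ++ zs))) ⟩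
    lookup (y ∷ ys ++ zs)                       ∎

  fibreIso-concatMap-replicate : ∀ m k (f : Fin k → X) →
    FibreIso {A = Fin k × Fin m} (f ∘ proj₁) (lookup (concatMap (replicate m) (tabulate f)))
  fibreIso-concatMap-replicate m zero    f = fibreIso-Fin0× (f ∘ proj₁) (lookup [])
  fibreIso-concatMap-replicate m (suc k) f =
    f ∘ proj₁                                 ↔⟨ fibreIso-Fin-suc× (f ∘ proj₁) ⟩
    [ const (f zero) , f ∘ suc ∘ proj₁ ]′     ↔⟨ fibreIso-⊎ (fibreIso-replicate m (f zero))
                                                             (fibreIso-concatMap-replicate m k (f ∘ suc)) ⟩
    [ lookup first , lookup rest ]′           ↔⟨ fibreIso-++ first rest ⟩
    lookup (first ++ rest)                    ∎
    where
    first rest : List X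
    first = replicate m (f zero)
    rest  = concatMap (replicate m) (tabulate (f ∘ suc))

fibreIso-classify : ∀ {X : Set} {k} (o : Fin k → X) {c c′ : X} → c′ ≡ c →
                    FibreIso [ o , const c ]′ (maybe o c′ ∘ classify)
fibreIso-classify {k = k} o {c} {c′} c′≡c =
  mkFibreIso (mk↔ₛ′ embed unembed embed∘unembed unembed∘embed) over
  where
  embed : Fin k ⊎ ⊤ → Fin (suc k)
  embed = [ inject₁ , const (fromℕ k) ]′
  unembed : Fin (suc k) → Fin k ⊎ ⊤
  unembed = maybe inj₁ (inj₂ tt) ∘ classify
  embed∘unembed : ∀ x → embed (unembed x) ≡ x
  embed∘unembed x with classify x in e
  ... | just a  = sym (classify≡just⇒inject₁ e)
  ... | nothing = sym (classify≡nothing⇒fromℕ e)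
  unembed∘embed : ∀ z → unembed (embed z) ≡ z
  unembed∘embed (inj₁ a)  rewrite classify-inject₁ a = refl
  unembed∘embed (inj₂ tt) rewrite classify-fromℕ k = refl
  over : ∀ z → maybe o c′ (classify (embed z)) ≡ [ o , const c ]′ z
  over (inj₁ a)  rewrite classify-inject₁ a = refl
  over (inj₂ tt) rewrite classify-fromℕ k = c′≡c

duplicateList-blowup : ∀ {G H} → Symmetric G → (B : Blowup G H) → (vs : List (Fin (n G))) →
  Σ (Blowup G (duplicateList H (Blowup.lift B) vs)) λ B′ →
    FibreIso [ Blowup.origin B , lookup vs ]′ (Blowup.origin B′)
duplicateList-blowup G-sym B [] = B , fibreIso-Fin0ʳ (Blowup.origin B) (lookup [])
duplicateList-blowup {G} {H} G-sym B (v ∷ vs)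
  with duplicateList-blowup G-sym (duplicate-blowup G-sym B (Blowup.lift B v)) vs
... | B′ , B′-over = B′ ,
  ([ origin , lookup (v ∷ vs) ]′               ↔⟨ fibreIso-⊎ fibreIso-refl (fibreIso-Fin-suc (lookup (v ∷ vs))) ⟩
   [ origin , [ const v , lookup vs ]′ ]′      ↔⟨ fibreIso-sym (fibreIso-assoc origin (const v) (lookup vs)) ⟩
   [ [ origin , const v ]′ , lookup vs ]′      ↔⟨ fibreIso-⊎ (fibreIso-classify origin (origin-lift v)) fibreIso-refl ⟩
   [ origin′ , lookup vs ]′                   ↔⟨ B′-over ⟩
   Blowup.origin B′                           ∎)
  where
  open Blowup B
  origin′ : Fin (suc (n H)) → Fin (n G)
  origin′ = Blowup.origin (duplicate-blowup G-sym B (lift v))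

blowup-≅ : ∀ {G H₁ H₂} (B₁ : Blowup G H₁) (B₂ : Blowup G H₂) →
  FibreIso (Blowup.origin B₁) (Blowup.origin B₂) → H₁ ≅ H₂
blowup-≅ {G} {H₁} {H₂} B₁ B₂ (mkFibreIso f f-over) = f , adj-preserved
  where
  open Inverse f using (to)
  adj-preserved : ∀ x y → adj H₁ x y ≡ adj H₂ (to x) (to y)
  adj-preserved x y rewrite Blowup.adj-blowup B₁ x y | Blowup.adj-blowup B₂ (to x) (to y)
    | f-over x | f-over y | ==-injective (Injection.injective (↔⇒↣ f)) x y = refl

strongProduct≅duplicateEach : ∀ m G → IsSimple G → (K (suc m) ⊠ G) ≅ duplicateEach m G
strongProduct≅duplicateEach m G G-simple@(G-sym , _) =
  blowup-≅ product duplicated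
    (Blowup.origin product       ↔⟨ mkFibreIso *↔× (λ _ → refl) ⟩
     proj₂                       ↔⟨ fibreIso-Fin-suc× proj₂ ⟩
     [ id , proj₂ ]′             ↔⟨ fibreIso-⊎ fibreIso-refl (fibreIso-swap proj₂) ⟩
     [ id , proj₁ ]′             ↔⟨ fibreIso-⊎ fibreIso-refl (fibreIso-concatMap-replicate m (n G) id) ⟩
     [ id , lookup copies ]′     ↔⟨ proj₂ duplication ⟩
     Blowup.origin duplicated    ∎)
  where
  product : Blowup G (K (suc m) ⊠ G)
  product = strongProduct-blowup m G
  copies : List (Fin (n G))
  copies = concatMap (replicate m) (allFin (n G))
  duplication : Σ (Blowup G (duplicateEach m G)) λ B → FibreIso [ id , lookup copies ]′ (Blowup.origin B)
  duplication = duplicateList-blowup G-sym (identity-blowup G G-simple) copies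
  duplicated : Blowup G (duplicateEach m G)
  duplicated = proj₁ duplication

mainTheorem16 : (G : Graph) (m : ℕ) → MinimalPrime G →
    MinimalPrime (K (suc m) ⊠ G) × ((K (suc m) ⊠ G) ≅ duplicateEach m G)
mainTheorem16 G m mp =
  BlowupProperties.blowup-minimalPrime (strongProduct-blowup m G) mp , strongProduct≅duplicateEach m G (proj₁ mp)
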